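{- Let $M\subset\mathbb{R}^N$ be a finite set with $|M|\ge 2$, equipped with the Euclidean metric $d$, and suppose $M$ is distance separated. Then the connected sparse graph $CS(M)$ is a tree.
   Context: $M$ is distance separated if all distances $d(x,y)$ between distinct unordered pairs $\{x,y\}\subset M$ are pairwise different. Construction of $CS(M)$ (all graphs simple, undirected, with vertex set $M$): $S_0$ has no edges, $K_0=\{\{x\}:x\in M\}$; $\nu_0(\{x\})=\min\{d(x,y):y\neq x\}$; $E(S_1)=\bigcup_{x}\{\{x,y\}:y\neq x,\ d(x,y)=\nu_0(\{x\})\}$. If $S_i$ has set of connected components $K_i$ with $|K_i|>1$, let $\nu_i(k)=\min\{d(x,y):x\in k, y\notin k\}$ for $k\in K_i$, $F(S_{i+1})=\bigcup_{k\in K_i}\{\{x,y\}:x\in k,\ y\notin k,\ d(x,y)=\nu_i(k)\}$ and $E(S_{i+1})=E(S_i)\cup F(S_{i+1})$. The construction stops at the first index $i$ such that $S_i$ is connected, and $CS(M):=S_i$. -}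

module Defs where

open import Level using (Level; Lift; _⊔_)
open import Data.Empty using (⊥)
open import Data.Nat using (ℕ; zero; suc; _<_; _+_)
open import Data.Fin using (Fin; inject₁; fromℕ) renaming (zero to fzero; suc to fsuc)
open import Data.Product using (Σ; _×_)
open import Data.Sum using (_⊎_)
open import Relation.Nullary using (¬_)
open import Relation.Binary.PropositionalEquality using (_≡_; _≢_)
open import Relation.Binary.Bundles using (StrictTotalOrder)
open import Relation.Binary.Core using (Rel)
open import Relation.Binary.Construct.Closure.ReflexiveTransitive using (Star)
open import Function.Definitions using (Injective)

-- A simple undirected graph on vertex set Fin n is given by a
-- (symmetric, irreflexive) edge relation.

Connected : ∀ {n ℓ} → Rel (Fin n) ℓ → Set ℓ
Connected {n} E = (x y : Fin n) → Star E x y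

Cycle : ∀ {n ℓ} → Rel (Fin n) ℓ → Set ℓ
Cycle {n} E =
  Σ ℕ λ k → Σ (Fin (3 + k) → Fin n) λ v →
    Injective _≡_ _≡_ v
    × ((i : Fin (2 + k)) → E (v (inject₁ i)) (v (fsuc i)))
    × E (v (fromℕ (2 + k))) (v fzero)

IsTree : ∀ {n ℓ} → Rel (Fin n) ℓ → Set ℓ
IsTree E = Connected E × ¬ Cycle E

-- Finite "metric-like" data: points are Fin n, distances take values in a
-- strict total order O (e.g. the reals); d x y is the distance of {x,y}.
module Construction {a ℓ₁ ℓ₂ : Level} (O : StrictTotalOrder a ℓ₁ ℓ₂)
                    {n : ℕ} (d : Fin n → Fin n → StrictTotalOrder.Carrier O) where
  open StrictTotalOrder O renaming (_<_ to _≺_)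

  DistanceSeparated : Set (ℓ₁)
  DistanceSeparated = ∀ x y u v → x ≢ y → u ≢ v → d x y ≈ d u v →
                      (x ≡ u × y ≡ v) ⊎ (x ≡ v × y ≡ u)

  mutual
    E : ℕ → Rel (Fin n) ℓ₂
    E zero    _ _ = Lift ℓ₂ ⊥
    E (suc i) x y = E i x y ⊎ (MinOut i x y ⊎ MinOut i y x)

    Conn : ℕ → Rel (Fin n) ℓ₂
    Conn i = Star (E i)

    -- {x,y} with x ∈ k := component of x in S_i, y ∉ k, and
    -- d(x,y) = ν_i(k) = min { d(x',y') : x' ∈ k, y' ∉ k }
    MinOut : ℕ → Rel (Fin n) ℓ₂
    MinOut i x y = ¬ Conn i x y ×
      ((x' y' : Fin n) → Conn i x x' → ¬ Conn i x y' → ¬ (d x' y' ≺ d x y))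

  S : ℕ → Rel (Fin n) ℓ₂
  S = E

  -- "CS(M) = S_i": i is the first index with S_i connected
  IsStoppingIndex : ℕ → Set ℓ₂
  IsStoppingIndex i = Connected (S i) × ((j : ℕ) → j < i → ¬ Connected (S j))

module Submission where

-- Termination: the component of a fixed vertex in S_i grows strictly (by the endpoint of
-- its minimal outgoing edge) until S_i is connected, so some S_i is connected and the least
-- such i is the stopping index.  Acyclicity: take the heaviest edge {u, u′} of a cycle in S_I;
-- it entered the construction as a minimal outgoing edge of the component K of u in some S_J.
-- The rest of the cycle leads from u′ back to u, so another cycle edge leaves K.  That edge is
-- no heavier than {u, u′} by choice and no lighter by minimality, so distance separation makes
-- it equal to {u, u′}, which a cycle of length at least 3 does not allow.

open import Defs
open import Level using (Level; Lift; lift; lower)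
open import Data.Bool using (Bool) renaming (_≟_ to _≟ᵇ_)
open import Data.Empty using (⊥)
open import Data.List using (List; filter; upTo; allFin; cartesianProduct)
open import Data.List.Membership.Propositional using (_∈_)
open import Data.List.Membership.Propositional.Properties using (∈-filter⁺; ∈-upTo⁺; ∈-allFin; ∈-cartesianProduct⁺)
open import Data.List.Relation.Unary.All using (lookup)
open import Data.List.Relation.Unary.All.Properties using (all-filter)
open import Data.Nat using (ℕ; zero; suc; _+_; _<_; _≤_; s≤s; z≤n; _<?_)
open import Data.Nat.DivMod using (_mod_; n%n≡0; m<n⇒m%n≡m)
open import Data.Nat.Induction using (<-rec)
open import Data.Nat.Properties using (anyUpTo?; ≤-<-trans; <⇒≱; m≤n⇒m≤1+n; m≤n⇒m<n∨m≡n; ≤-refl; <-irrefl; <-trans; <⇒≢)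
open import Data.Fin using (Fin; _≟_; toℕ; fromℕ; fromℕ<; inject₁) renaming (zero to fzero; suc to fsuc)
open import Data.Fin.Properties using (any?; all?; ¬∀⟶∃¬; toℕ<n; toℕ-injective; toℕ-fromℕ<; toℕ-fromℕ; toℕ-inject₁)
open import Data.Fin.Subset using (Subset; ∣_∣) renaming (_∈_ to _∈ₛ_; _⊂_ to _⊂ₛ_)
open import Data.Fin.Subset.Properties using (∣p∣≤n; p⊂q⇒∣p∣<∣q∣)
open import Data.Vec using (tabulate)
open import Data.Vec.Properties using (lookup∘tabulate; lookup⇒[]=; []=⇒lookup)
open import Data.Product using (Σ; ∃; ∃-syntax; _×_; _,_; uncurry; proj₁; proj₂)
open import Data.Sum using (_⊎_; inj₁; inj₂)
open import Function using (_∘_)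
open import Function.Definitions using (Injective)
open import Relation.Nullary using (¬_; Dec; yes; no; does; contradiction)
open import Relation.Nullary.Decidable using (dec-true; dec-false; decidable-stable; ¬?; _⊎-dec_; _×-dec_; _→-dec_; map′)
open import Relation.Unary using (Pred; _⊆_; _⊂_) renaming (Decidable to Decidable₁)
open import Relation.Binary.Core using (Rel)
open import Relation.Binary.Bundles using (StrictTotalOrder; DecTotalOrder)
open import Relation.Binary.Definitions using (Decidable; DecidableEquality; tri<; tri≈; tri>)
open import Relation.Binary.PropositionalEquality using (_≡_; _≢_; refl; sym; trans; cong; subst; subst₂; ≢-sym)
open import Relation.Binary.Construct.Closure.ReflexiveTransitive using (Star; ε; _◅_; _◅◅_)
import Relation.Binary.Construct.Closure.ReflexiveTransitive as Star
import Relation.Binary.Construct.Flip.EqAndOrd as Flip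
import Relation.Binary.Properties.StrictTotalOrder as StrictTotalOrderProperties
import Data.List.Extrema as Extrema

least-satisfying : ∀ {p} {P : Pred ℕ p} → Decidable₁ P → ∀ {m} → P m →
                   ∃[ i ] P i × ((j : ℕ) → j < i → ¬ P j)
least-satisfying {p} {P} P? {m} = <-rec (λ m → P m → Least) least m
  where
  Least : Set p
  Least = ∃[ i ] P i × ((j : ℕ) → j < i → ¬ P j)
  least : ∀ m → (∀ {j} → j < m → P j → Least) → P m → Least
  least m rec Pm with anyUpTo? P? m
  ... | yes (j , j<m , Pj) = rec j<m Pj
  ... | no none            = m , Pm , λ j j<m Pj → none (j , j<m , Pj)

module _ {n ℓ} {P : Pred (Fin n) ℓ} (P? : Decidable₁ P) where

  toSubset : Subset n
  toSubset = tabulate (does ∘ P?)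

  ∈-toSubset⁺ : ∀ {x} → P x → x ∈ₛ toSubset
  ∈-toSubset⁺ {x} Px = lookup⇒[]= x toSubset (trans (lookup∘tabulate _ x) (dec-true (P? x) Px))

  ∈-toSubset⁻ : ∀ {x} → x ∈ₛ toSubset → P x
  ∈-toSubset⁻ {x} x∈ with P? x | trans (sym (lookup∘tabulate (does ∘ P?) x)) ([]=⇒lookup x∈)
  ... | yes Px | _ = Px

module _ {n ℓ q} {P : ℕ → Pred (Fin n) ℓ} (P? : ∀ k → Decidable₁ (P k)) {Q : ℕ → Set q} where

  private
    ⊂⇒⊂ₛ : ∀ k → P k ⊂ P (suc k) → toSubset (P? k) ⊂ₛ toSubset (P? (suc k))
    ⊂⇒⊂ₛ k (P⊆ , P⊈) with ¬∀⟶∃¬ n _ (λ x → ¬? (P? (suc k) x ×-dec ¬? (P? k x))) some-new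
      where
      some-new : ¬ (∀ x → ¬ (P (suc k) x × ¬ P k x))
      some-new none = P⊈ λ {x} Px → decidable-stable (P? k x) (λ ¬Px → none x (Px , ¬Px))
    ... | x , ¬¬new with decidable-stable (P? (suc k) x ×-dec ¬? (P? k x)) ¬¬new
    ...   | Px , ¬Px = ∈-toSubset⁺ (P? (suc k)) ∘ P⊆ ∘ ∈-toSubset⁻ (P? k) ,
                       x , ∈-toSubset⁺ (P? (suc k)) Px , ¬Px ∘ ∈-toSubset⁻ (P? k)

    size-bound : (∀ k → Q k ⊎ P k ⊂ P (suc k)) → ∀ k → ∃ Q ⊎ k ≤ ∣ toSubset (P? k) ∣
    size-bound step zero = inj₂ z≤n
    size-bound step (suc k) with size-bound step k | step k
    ... | inj₁ q  | _       = inj₁ q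
    ... | inj₂ _  | inj₁ Qk = inj₁ (k , Qk)
    ... | inj₂ k≤ | inj₂ P⊂ = inj₂ (≤-<-trans k≤ (p⊂q⇒∣p∣<∣q∣ (⊂⇒⊂ₛ k P⊂)))

  grows-until : (∀ k → Q k ⊎ P k ⊂ P (suc k)) → ∃ Q
  grows-until step with size-bound step (suc n)
  ... | inj₁ q  = q
  ... | inj₂ n< = contradiction (∣p∣≤n (toSubset (P? (suc n)))) (<⇒≱ n<)

module _ {n ℓ} {R : Rel (Fin n) ℓ} (R? : Decidable R) where

  Within : ℕ → Rel (Fin n) ℓ
  Within zero    x y = Lift ℓ (x ≡ y)
  Within (suc k) x y = Within k x y ⊎ ∃[ z ] Within k x z × R z y

  Within? : ∀ k → Decidable (Within k)
  Within? zero    x y = map′ lift lower (x ≟ y)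
  Within? (suc k) x y = Within? k x y ⊎-dec any? λ z → Within? k x z ×-dec R? z y

  Within-refl : ∀ k {x} → Within k x x
  Within-refl zero    = lift refl
  Within-refl (suc k) = inj₁ (Within-refl k)

  Within⇒Star : ∀ k {x y} → Within k x y → Star R x y
  Within⇒Star zero    (lift refl)          = ε
  Within⇒Star (suc k) (inj₁ w)             = Within⇒Star k w
  Within⇒Star (suc k) (inj₂ (z , w , Rzy)) = Within⇒Star k w ◅◅ (Rzy ◅ ε)

  Star⇒Within : ∀ {k x z y} → Within (suc k) x ⊆ Within k x →
                Within k x z → Star R z y → Within k x y
  Star⇒Within closed w ε           = w
  Star⇒Within closed w (Rzz′ ◅ s) = Star⇒Within closed (closed (inj₂ (_ , w , Rzz′))) s

  Star? : Decidable (Star R)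
  Star? x y with grows-until (λ k → Within? k x) saturates
    where
    saturates : ∀ k → Within (suc k) x ⊆ Within k x ⊎ Within k x ⊂ Within (suc k) x
    saturates k with all? (λ y → Within? (suc k) x y →-dec Within? k x y)
    ... | yes closed = inj₁ (closed _)
    ... | no ¬closed = inj₂ (inj₁ , λ closed → ¬closed (λ y → closed))
  ... | k , closed = map′ (Within⇒Star k) (Star⇒Within closed (Within-refl k)) (Within? k x y)

module _ {a ℓ₁ ℓ₂} (O : StrictTotalOrder a ℓ₁ ℓ₂) where
  open StrictTotalOrder O renaming (_<_ to _≺_)
  open StrictTotalOrderProperties O using (decTotalOrder) renaming (_≤_ to _≼_)
  open Extrema (DecTotalOrder.totalOrder decTotalOrder) using (argmin; argmin-all; f[argmin]≤f[xs])

  ∃-minimiser : ∀ {b p} {A : Set b} (f : A → Carrier) (xs : List A) {P : Pred A p} →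
                Decidable₁ P → (∀ {x} → P x → x ∈ xs) → ∃ P →
                ∃[ x ] P x × (∀ {y} → P y → ¬ f y ≺ f x)
  ∃-minimiser {A = A} f xs P? complete (x₀ , Px₀) =
    x , argmin-all f Px₀ (all-filter P? xs) ,
    λ Py → ≼⇒⊀ (lookup (f[argmin]≤f[xs] x₀ (filter P? xs)) (∈-filter⁺ P? (complete Py) Py))
    where
    x : A
    x = argmin f x₀ (filter P? xs)
    ≼⇒⊀ : ∀ {u v} → u ≼ v → ¬ v ≺ u
    ≼⇒⊀ (inj₁ u≺v) v≺u = asym u≺v v≺u
    ≼⇒⊀ (inj₂ u≈v) v≺u = irrefl (Eq.sym u≈v) v≺u

module _ {a} {A : Set a} (_≟ᴬ_ : DecidableEquality A) (p : ℕ → A) where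

  crossing : ∀ {i j} → i ≤ j → p i ≢ p j → ∃[ k ] i ≤ k × k < j × p k ≢ p (suc k)
  crossing i≤j pi≢pj with m≤n⇒m<n∨m≡n i≤j
  ... | inj₂ refl = contradiction refl pi≢pj
  crossing {j = suc j} _ pi≢pj | inj₁ (s≤s i≤j) with p j ≟ᴬ p (suc j)
  ... | no pj≢ = j , i≤j , ≤-refl , pj≢
  ... | yes pj≡ with crossing i≤j (λ pi≡pj → pi≢pj (trans pi≡pj pj≡))
  ...   | k , i≤k , k<j , pk≢ = k , i≤k , m≤n⇒m≤1+n k<j , pk≢

  another-crossing : ∀ {m i} → p m ≡ p 0 → i < m → p i ≢ p (suc i) →
                     ∃[ j ] j < m × j ≢ i × p j ≢ p (suc j)
  another-crossing closed i<m pi≢ with p 0 ≟ᴬ p _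
  ... | no p0≢ with crossing z≤n p0≢
  ...   | j , _ , j<i , pj≢ = j , <-trans j<i i<m , <⇒≢ j<i , pj≢
  another-crossing closed i<m pi≢ | yes p0≡
    with crossing i<m (λ pi+1≡pm → pi≢ (sym (trans pi+1≡pm (trans closed p0≡))))
  ... | j , i<j , j<m , pj≢ = j , j<m , (λ j≡i → <-irrefl (sym j≡i) i<j) , pj≢

does-≢ : ∀ {a b} {A : Set a} {B : Set b} (a? : Dec A) (b? : Dec B) →
         does a? ≢ does b? → (A × ¬ B) ⊎ (¬ A × B)
does-≢ (yes a)  (no ¬b)  _  = inj₁ (a , ¬b)
does-≢ (no ¬a)  (yes b)  _  = inj₂ (¬a , b)
does-≢ (yes _)  (yes _)  ne = contradiction refl ne
does-≢ (no _)   (no _)   ne = contradiction refl ne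

SamePair : ∀ {a} {A : Set a} → A → A → A → A → Set a
SamePair x y u v = (x ≡ u × y ≡ v) ⊎ (x ≡ v × y ≡ u)

SamePair-swap : ∀ {a} {A : Set a} {x y u v : A} → SamePair x y u v → SamePair y x u v
SamePair-swap (inj₁ (x≡u , y≡v)) = inj₂ (y≡v , x≡u)
SamePair-swap (inj₂ (x≡v , y≡u)) = inj₁ (y≡u , x≡v)

module ClosedWalk {n ℓ} {R : Rel (Fin n) ℓ} {k} {v : Fin (3 + k) → Fin n}
                  (v-injective : Injective _≡_ _≡_ v)
                  (path : (i : Fin (2 + k)) → R (v (inject₁ i)) (v (fsuc i)))
                  (close : R (v (fromℕ (2 + k))) (v fzero)) where

  m : ℕ
  m = 3 + k

  toℕ-mod : ∀ {j} → j < m → toℕ (j mod m) ≡ j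
  toℕ-mod j<m = trans (toℕ-fromℕ< _) (m<n⇒m%n≡m j<m)

  -- Opaque because unfolding _mod_ during unification makes checking very slow.
  opaque
    w : ℕ → Fin n
    w j = v (j mod m)

    w-toℕ : ∀ {j} (t : Fin m) → toℕ t ≡ j → w j ≡ v t
    w-toℕ t refl = cong v (toℕ-injective (toℕ-mod (toℕ<n t)))

    w-closed : w m ≡ w 0
    w-closed = cong v (toℕ-injective (trans (toℕ-fromℕ< _) (n%n≡0 m)))

    w-injective : ∀ {i j} → i < m → j < m → w i ≡ w j → i ≡ j
    w-injective {i} {j} i<m j<m wi≡wj =
      trans (sym (toℕ-mod i<m)) (trans (cong toℕ (v-injective wi≡wj)) (toℕ-mod j<m))

  w-step : ∀ {j} → j < m → R (w j) (w (suc j))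
  w-step j<m with m≤n⇒m<n∨m≡n j<m
  ... | inj₁ (s≤s j<2+k) = subst₂ R (sym (w-toℕ (inject₁ t) (trans (toℕ-inject₁ t) (toℕ-fromℕ< j<2+k))))
                                   (sym (w-toℕ (fsuc t) (cong suc (toℕ-fromℕ< j<2+k))))
                                   (path t)
    where
    t : Fin (2 + k)
    t = fromℕ< j<2+k
  ... | inj₂ refl = subst₂ R (sym (w-toℕ (fromℕ (2 + k)) (toℕ-fromℕ (2 + k))))
                             (sym (trans w-closed (w-toℕ fzero refl)))
                             close

  w-edges-distinct : ∀ {i j} → i < m → j < m →
                     SamePair (w j) (w (suc j)) (w i) (w (suc i)) → j ≡ i
  w-edges-distinct i<m j<m (inj₁ (wj≡wi , _)) = w-injective j<m i<m wj≡wi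
  w-edges-distinct {i} {j} i<m j<m (inj₂ (wj≡wi+1 , wj+1≡wi))
    with m≤n⇒m<n∨m≡n i<m | m≤n⇒m<n∨m≡n j<m
  ... | inj₁ i+1<m | inj₁ j+1<m
    with refl ← w-injective j<m i+1<m wj≡wi+1
    with () ← w-injective j+1<m i<m wj+1≡wi
  ... | inj₂ refl | _
    with refl ← w-injective j<m (s≤s z≤n) (trans wj≡wi+1 w-closed)
    with () ← w-injective (s≤s (s≤s z≤n)) i<m wj+1≡wi
  ... | _ | inj₂ refl
    with refl ← w-injective (s≤s z≤n) i<m (trans (sym w-closed) wj+1≡wi)
    with () ← w-injective j<m (s≤s (s≤s z≤n)) wj≡wi+1

module _ {a ℓ₁ ℓ₂} (O : StrictTotalOrder a ℓ₁ ℓ₂) {n} (d : Fin n → Fin n → StrictTotalOrder.Carrier O) where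
  open StrictTotalOrder O renaming (_<_ to _≺_; _<?_ to _≺?_)
  open Construction O d

  E-sym : ∀ {i x y} → E i x y → E i y x
  E-sym {zero}  ()
  E-sym {suc i} (inj₁ e)        = inj₁ (E-sym e)
  E-sym {suc i} (inj₂ (inj₁ e)) = inj₂ (inj₂ e)
  E-sym {suc i} (inj₂ (inj₂ e)) = inj₂ (inj₁ e)

  Conn-sym : ∀ {i x y} → Conn i x y → Conn i y x
  Conn-sym = Star.reverse E-sym

  Conn-suc : ∀ {i x y} → Conn i x y → Conn (suc i) x y
  Conn-suc = Star.map inj₁

  E-origin : ∀ {i x y} → E i x y → ∃[ j ] (MinOut j x y ⊎ MinOut j y x)
  E-origin {suc i} (inj₁ e) = E-origin e
  E-origin {suc i} (inj₂ e) = i , e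

  mutual
    E? : ∀ i → Decidable (E i)
    E? zero    x y = no lower
    E? (suc i) x y = E? i x y ⊎-dec (MinOut? i x y ⊎-dec MinOut? i y x)

    MinOut? : ∀ i → Decidable (MinOut i)
    MinOut? i x y = ¬? (Conn? i x y) ×-dec
      all? λ x′ → all? λ y′ → Conn? i x x′ →-dec ¬? (Conn? i x y′) →-dec ¬? (d x′ y′ ≺? d x y)

    Conn? : ∀ i → Decidable (Conn i)
    Conn? i = Star? (E? i)

  Connected? : ∀ i → Dec (Connected (S i))
  Connected? i = all? λ x → all? λ y → Conn? i x y

  minOut-exists : ∀ {i x y} → ¬ Conn i x y → ∃[ p ] ∃[ q ] Conn i x p × MinOut i p q
  minOut-exists {i} {x} {y} ¬x~y =
    let (p , q) , (x~p , ¬x~q) , cheapest =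
          ∃-minimiser O (uncurry d) (cartesianProduct (allFin n) (allFin n))
            (λ (p , q) → Conn? i x p ×-dec ¬? (Conn? i x q))
            (λ {(p , q)} _ → ∈-cartesianProduct⁺ (∈-allFin p) (∈-allFin q))
            ((x , y) , ε , ¬x~y)
    in p , q , x~p , (λ p~q → ¬x~q (x~p ◅◅ p~q)) ,
       λ x′ y′ p~x′ ¬p~y′ → cheapest (x~p ◅◅ p~x′ , λ x~y′ → ¬p~y′ (Conn-sym x~p ◅◅ x~y′))

  component-grows : ∀ {i x y} → ¬ Conn i x y → Conn i x ⊂ Conn (suc i) x
  component-grows ¬x~y =
    let p , q , x~p , minOut@(¬p~q , _) = minOut-exists ¬x~y
    in Conn-suc , λ ⊆Conn-i → ¬p~q (Conn-sym x~p ◅◅ ⊆Conn-i (Conn-suc x~p ◅◅ (inj₂ (inj₁ minOut) ◅ ε)))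

  eventually-connected : Fin n → ∃[ i ] Connected (S i)
  eventually-connected x = grows-until (λ i → Conn? i x) (λ i → connected-or-grows (all? (Conn? i x)))
    where
    connected-or-grows : ∀ {i} → Dec (∀ y → Conn i x y) → Connected (S i) ⊎ Conn i x ⊂ Conn (suc i) x
    connected-or-grows (yes x~all) = inj₁ λ y z → Conn-sym (x~all y) ◅◅ x~all z
    connected-or-grows {i} (no ¬x~all) = inj₂ (component-grows (proj₂ (¬∀⟶∃¬ n _ (Conn? i x) ¬x~all)))

  stopping-index : Fin n → ∃[ i ] IsStoppingIndex i
  stopping-index x = least-satisfying Connected? (proj₂ (eventually-connected x))

  module _ (d-sym : ∀ x y → d x y ≈ d y x) (separated : DistanceSeparated) where

    minOut-unique : ∀ {J u v p q} → MinOut J u v → Conn J u p → ¬ Conn J u q →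
                    ¬ d u v ≺ d p q → p ≡ u × q ≡ v
    minOut-unique {J} {u} {v} {p} {q} (¬u~v , cheapest) u~p ¬u~q ⊁ with compare (d p q) (d u v)
    ... | tri< pq≺uv _ _ = contradiction pq≺uv (cheapest p q u~p ¬u~q)
    ... | tri> _ _ uv≺pq = contradiction uv≺pq ⊁
    ... | tri≈ _ pq≈uv _ with separated p q u v (λ p≡q → ¬u~q (subst (Conn J u) p≡q u~p))
                                              (λ u≡v → ¬u~v (subst (Conn J u) u≡v ε)) pq≈uv
    ...   | inj₁ same = same
    ...   | inj₂ (p≡v , _) = contradiction (subst (Conn J u) p≡v u~p) ¬u~v

    module _ {I k} {v : Fin (3 + k) → Fin n} (v-injective : Injective _≡_ _≡_ v)
             (path : (i : Fin (2 + k)) → E I (v (inject₁ i)) (v (fsuc i)))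
             (close : E I (v (fromℕ (2 + k))) (v fzero)) where
      open ClosedWalk {R = E I} v-injective path close

      weight : ℕ → Carrier
      weight j = d (w j) (w (suc j))

      weight-SamePair : ∀ {j p q} → SamePair p q (w j) (w (suc j)) → d p q ≈ weight j
      weight-SamePair (inj₁ (refl , refl)) = Eq.refl
      weight-SamePair (inj₂ (refl , refl)) = d-sym _ _

      heaviest-not-minOut : ∀ {i J u u′} → i < m → (∀ {j} → j < m → ¬ weight i ≺ weight j) →
                            MinOut J u u′ → SamePair u u′ (w i) (w (suc i)) → ⊥
      heaviest-not-minOut {i} {J} {u} {u′} i<m heaviest minOut uu′≐i
        with another-crossing _≟ᵇ_ (colour ∘ w) (cong colour w-closed) i<m (separates uu′≐i)
        where
        colour : Fin n → Bool
        colour x = does (Conn? J u x)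

        colour-cut : ∀ {x y} → Conn J u x → ¬ Conn J u y → colour x ≢ colour y
        colour-cut {x} {y} u~x ¬u~y rewrite dec-true (Conn? J u x) u~x | dec-false (Conn? J u y) ¬u~y = λ ()

        separates : ∀ {x y} → SamePair u u′ x y → colour x ≢ colour y
        separates (inj₁ (refl , refl)) = colour-cut ε (proj₁ minOut)
        separates (inj₂ (refl , refl)) = ≢-sym (colour-cut ε (proj₁ minOut))
      ... | j , j<m , j≢i , cut-j with does-≢ (Conn? J u (w j)) (Conn? J u (w (suc j))) cut-j
      ...   | inj₁ (u~p , ¬u~q)
        with refl , refl ← minOut-unique minOut u~p ¬u~q
                             (heaviest j<m ∘ <-respˡ-≈ (weight-SamePair {i} uu′≐i))
        = j≢i (w-edges-distinct i<m j<m uu′≐i)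
      ...   | inj₂ (¬u~p , u~q)
        with refl , refl ← minOut-unique minOut u~q ¬u~p
                             (heaviest j<m ∘ <-respˡ-≈ (weight-SamePair {i} uu′≐i) ∘ <-respʳ-≈ (d-sym _ _))
        = j≢i (w-edges-distinct i<m j<m (SamePair-swap uu′≐i))

      heaviest-edge : ∃[ i ] i < m × (∀ {j} → j < m → ¬ weight i ≺ weight j)
      heaviest-edge = ∃-minimiser (Flip.strictTotalOrder O) weight (upTo m) (_<? m) ∈-upTo⁺ (0 , s≤s z≤n)

      heaviest-not-edge : ∀ {i} → i < m → (∀ {j} → j < m → ¬ weight i ≺ weight j) →
                          ¬ E I (w i) (w (suc i))
      heaviest-not-edge i<m heaviest e with E-origin e
      ... | J , inj₁ minOut = heaviest-not-minOut i<m heaviest minOut (inj₁ (refl , refl))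
      ... | J , inj₂ minOut = heaviest-not-minOut i<m heaviest minOut (inj₂ (refl , refl))

      no-such-cycle : ⊥
      no-such-cycle = let i , i<m , heaviest = heaviest-edge
                      in heaviest-not-edge i<m heaviest (w-step i<m)

    cycle-free : ∀ {I} → ¬ Cycle (S I)
    cycle-free (_ , _ , v-injective , path , close) = no-such-cycle v-injective path close

theorem4p2 : ∀ {a ℓ₁ ℓ₂ : Level} (O : StrictTotalOrder a ℓ₁ ℓ₂) (n : ℕ) → 2 ≤ n →
    (d : Fin n → Fin n → StrictTotalOrder.Carrier O) →
    (∀ x y → StrictTotalOrder._≈_ O (d x y) (d y x)) →
    Construction.DistanceSeparated O d →
    Σ ℕ λ i → Construction.IsStoppingIndex O d i × IsTree (Construction.S O d i)
theorem4p2 O .(suc _) (s≤s _) d d-sym separated =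
  let i , stop@(connected , _) = stopping-index O d fzero
  in i , stop , connected , cycle-free O d d-sym separated
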